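{- Let $u,\tilde u,v$ be words over an alphabet $\mathcal{A}$ and let $n,m\ge0$ be integers. Assume that $u$ and $\tilde u$ are primitive and that $\tilde u^m$ is a suffix of $u^nv$ with $m|\tilde u|\ge|v|+|u|+|\tilde u|-\gcd(|u|,|\tilde u|)$. Then $|u|=|\tilde u|$, $u$ and $\tilde u$ are cyclic shifts of each other, and $u^nv\tilde u^q=u^{n+q}v$ for every integer $q\ge0$.
   Context: A word is primitive if it is nonempty and not of the form $w^j$ for a word $w$ and an integer $j\ge2$. Two words $u,\tilde u$ are cyclic shifts of each other if $u=st$ and $\tilde u=ts$ for some words $s,t$. -}

module Defs where

open import Data.List using (List; []; _∷_; _++_)
open import Data.Nat using (ℕ; zero; suc; _≥_)
open import Data.Product using (Σ; ∃; ∃-syntax; _×_)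
open import Relation.Binary.PropositionalEquality using (_≡_)
open import Relation.Nullary using (¬_)

infixr 8 _^ʷ_
_^ʷ_ : ∀ {a} {A : Set a} → List A → ℕ → List A
w ^ʷ zero  = []
w ^ʷ suc j = w ++ (w ^ʷ j)

IsSuffix : ∀ {a} {A : Set a} → List A → List A → Set a
IsSuffix {A = A} x y = ∃[ s ] (s ++ x ≡ y)

Primitive : ∀ {a} {A : Set a} → List A → Set a
Primitive {A = A} u = ¬ (u ≡ []) × ¬ (∃[ w ] ∃[ j ] (j ≥ 2 × u ≡ w ^ʷ j))

CyclicShift : ∀ {a} {A : Set a} → List A → List A → Set a
CyclicShift {A = A} u ũ = ∃[ s ] ∃[ t ] (u ≡ s ++ t × ũ ≡ t ++ s)

-- The occurrence of ũ^m starts inside one of the blocks u = a b of u^n, just after a,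
-- so ũ^m = b (a b)^k v.  Then z = b (a b)^k is a common prefix of (b a)^ω and ũ^ω whose
-- length, by the hypothesis, reaches the Fine–Wilf bound; hence b a and ũ are powers of
-- a common word.  Primitivity is invariant under conjugation, so b a = ũ.  Cancelling
-- (b a)^k from (b a)^m = (b a)^k b v shows that b v is a power of b a, whence v ũ = u v,
-- and this conjugation relation propagates to all powers of ũ.
module Submission where

open import Defs
open import Data.List using (List; []; _∷_; [_]; length; _++_)
open import Data.List.Properties
  using (++-assoc; ++-identityʳ; ++-cancelˡ; ++-conicalʳ; length-++; length-++-comm; length-++-≤ʳ; ∷-injective)
open import Data.Nat using (>-nonZero; ℕ; zero; suc; _+_; _*_; _∸_; _≥_; _≤_; _<_; z≤n; s≤s)
open import Data.Nat.Properties
open import Data.Nat.GCD using (gcd; gcd[m,n]∣m; gcd[m,n]∣n; gcd-greatest; gcd-comm; gcd[m,n]≤n)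
open import Data.Nat.Divisibility using (∣⇒≤; ∣m∣n⇒∣m+n; ∣m+n∣m⇒∣n; ∣-antisym)
open import Data.Nat.Induction using (<-wellFounded)
open import Induction.WellFounded using (Acc; acc)
open import Data.Product using (_×_; _,_; ∃-syntax)
open import Data.Sum using (inj₁; inj₂)
open import Data.Empty using (⊥-elim)
open import Relation.Nullary using (¬_)
open import Relation.Binary.PropositionalEquality
  using (_≡_; refl; sym; trans; cong; cong₂; subst; subst₂; module ≡-Reasoning)

gcd[m,m+n]≡gcd[m,n] : ∀ m n → gcd m (m + n) ≡ gcd m n
gcd[m,m+n]≡gcd[m,n] m n = ∣-antisym
  (gcd-greatest (gcd[m,n]∣m m (m + n))
     (∣m+n∣m⇒∣n (gcd[m,n]∣n m (m + n)) (gcd[m,n]∣m m (m + n))))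
  (gcd-greatest (gcd[m,n]∣m m n) (∣m∣n⇒∣m+n (gcd[m,n]∣m m n) (gcd[m,n]∣n m n)))

+-∸-cancelˡ-≤ : ∀ k {m n o} → o ≤ m → k + m ∸ o ≤ k + n → m ∸ o ≤ n
+-∸-cancelˡ-≤ k {n = n} o≤m le = +-cancelˡ-≤ k _ _ (subst (_≤ k + n) (+-∸-assoc k o≤m) le)

n≤m+n∸o : ∀ m n {o} → o ≤ m → n ≤ m + n ∸ o
n≤m+n∸o m n {o} o≤m = subst (n ≤_) (sym (+-∸-comm n o≤m)) (m≤n+m n (m ∸ o))

m≤m+n∸o : ∀ m n {o} → o ≤ n → m ≤ m + n ∸ o
m≤m+n∸o m n {o} o≤n = subst (m ≤_) (sym (+-∸-assoc m o≤n)) (m≤m+n m (n ∸ o))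

gcd[m,n]≤m : ∀ {m} n → 0 < m → gcd m n ≤ m
gcd[m,n]≤m {suc m} n _ = ∣⇒≤ (gcd[m,n]∣m (suc m) n)

module _ {a} {A : Set a} where

  IsPrefix : List A → List A → Set a
  IsPrefix x y = ∃[ t ] (x ++ t ≡ y)

  CommonRoot : List A → List A → Set a
  CommonRoot x y = ∃[ w ] ∃[ i ] ∃[ j ] (x ≡ w ^ʷ i × y ≡ w ^ʷ j)

  fineWilfBound : List A → List A → ℕ
  fineWilfBound x y = length x + length y ∸ gcd (length x) (length y)

  length-pos : ∀ {x : List A} → ¬ x ≡ [] → 0 < length x
  length-pos {[]}    x≢[] = ⊥-elim (x≢[] refl)
  length-pos {_ ∷ _} _    = s≤s z≤n

  levi : ∀ (w x y z : List A) → w ++ x ≡ y ++ z → length w ≤ length y →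
         ∃[ e ] (y ≡ w ++ e × x ≡ e ++ z)
  levi []      x y       z eq _         = y , refl , eq
  levi (c ∷ w) x (d ∷ y) z eq (s≤s w≤y) with ∷-injective eq
  ... | refl , eq′ with levi w x y z eq′ w≤y
  ...   | e , refl , refl = e , refl , refl

  length-^ʷ : ∀ (w : List A) j → length (w ^ʷ j) ≡ j * length w
  length-^ʷ w zero    = refl
  length-^ʷ w (suc j) = trans (length-++ w) (cong (length w +_) (length-^ʷ w j))

  []-^ʷ : ∀ j → [] ^ʷ j ≡ [] {A = A}
  []-^ʷ zero    = refl
  []-^ʷ (suc j) = []-^ʷ j

  ^ʷ-+ : ∀ (w : List A) i j → w ^ʷ (i + j) ≡ w ^ʷ i ++ w ^ʷ j
  ^ʷ-+ w zero    j = refl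
  ^ʷ-+ w (suc i) j = trans (cong (w ++_) (^ʷ-+ w i j)) (sym (++-assoc w _ _))

  ^ʷ-conjugate : ∀ {x y v : List A} → v ++ y ≡ x ++ v → ∀ q → v ++ y ^ʷ q ≡ x ^ʷ q ++ v
  ^ʷ-conjugate {x} {y} {v} vy≡xv zero    = ++-identityʳ v
  ^ʷ-conjugate {x} {y} {v} vy≡xv (suc q) = begin
    v ++ (y ++ y ^ʷ q)    ≡⟨ sym (++-assoc v y _) ⟩
    (v ++ y) ++ y ^ʷ q    ≡⟨ cong (_++ y ^ʷ q) vy≡xv ⟩
    (x ++ v) ++ y ^ʷ q    ≡⟨ ++-assoc x v _ ⟩
    x ++ (v ++ y ^ʷ q)    ≡⟨ cong (x ++_) (^ʷ-conjugate vy≡xv q) ⟩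
    x ++ (x ^ʷ q ++ v)    ≡⟨ sym (++-assoc x _ v) ⟩
    (x ++ x ^ʷ q) ++ v    ∎
    where open ≡-Reasoning

  ^ʷ-rotate : ∀ (x y : List A) k → x ++ (y ++ x) ^ʷ k ≡ (x ++ y) ^ʷ k ++ x
  ^ʷ-rotate x y = ^ʷ-conjugate (sym (++-assoc x y x))

  ^ʷ-rotate-++ : ∀ (x y : List A) k v → x ++ ((y ++ x) ^ʷ k ++ v) ≡ (x ++ y) ^ʷ k ++ (x ++ v)
  ^ʷ-rotate-++ x y k v = begin
    x ++ ((y ++ x) ^ʷ k ++ v)  ≡⟨ sym (++-assoc x _ v) ⟩
    (x ++ (y ++ x) ^ʷ k) ++ v  ≡⟨ cong (_++ v) (^ʷ-rotate x y k) ⟩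
    ((x ++ y) ^ʷ k ++ x) ++ v  ≡⟨ ++-assoc _ x v ⟩
    (x ++ y) ^ʷ k ++ (x ++ v)  ∎
    where open ≡-Reasoning

  ^ʷ-comm : ∀ (w : List A) j → w ^ʷ j ++ w ≡ w ++ w ^ʷ j
  ^ʷ-comm w j = sym (^ʷ-conjugate refl j)

  ^ʷ≡^ʷ++⇒^ʷ : ∀ (w y : List A) m k → w ^ʷ m ≡ w ^ʷ k ++ y → ∃[ j ] (y ≡ w ^ʷ j)
  ^ʷ≡^ʷ++⇒^ʷ w y m       zero    eq = m , sym eq
  ^ʷ≡^ʷ++⇒^ʷ w y zero    (suc k) eq = 0 , ++-conicalʳ (w ^ʷ suc k) y (sym eq)
  ^ʷ≡^ʷ++⇒^ʷ w y (suc m) (suc k) eq =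
    ^ʷ≡^ʷ++⇒^ʷ w y m k (++-cancelˡ w _ _ (trans eq (++-assoc w _ y)))

  rotate-^ʷ : ∀ c (r w : List A) i → c ∷ r ≡ w ^ʷ i → ∃[ w′ ] (r ++ [ c ] ≡ w′ ^ʷ i)
  rotate-^ʷ c r []      i       eq with () ← trans eq ([]-^ʷ i)
  rotate-^ʷ c r (d ∷ w) (suc i) eq with ∷-injective eq
  ... | refl , refl = w ++ [ c ] , (begin
    (w ++ (c ∷ w) ^ʷ i) ++ [ c ]  ≡⟨ ++-assoc w _ [ c ] ⟩
    w ++ ((c ∷ w) ^ʷ i ++ [ c ])  ≡⟨ cong (w ++_) (sym (^ʷ-rotate [ c ] w i)) ⟩
    w ++ (c ∷ (w ++ [ c ]) ^ʷ i)  ≡⟨ sym (++-assoc w [ c ] _) ⟩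
    (w ++ [ c ]) ^ʷ suc i         ∎)
    where open ≡-Reasoning

  conjugate-^ʷ : ∀ (x y w : List A) i → x ++ y ≡ w ^ʷ i → ∃[ w′ ] (y ++ x ≡ w′ ^ʷ i)
  conjugate-^ʷ []      y w i eq = w , trans (++-identityʳ y) eq
  conjugate-^ʷ (c ∷ x) y w i eq with rotate-^ʷ c (x ++ y) w i eq
  ... | w₁ , eq₁ with conjugate-^ʷ x (y ++ [ c ]) w₁ i (trans (sym (++-assoc x y [ c ])) eq₁)
  ...   | w₂ , eq₂ = w₂ , trans (sym (++-assoc y [ c ] x)) eq₂

  Primitive-conjugate : ∀ (x y : List A) → Primitive (x ++ y) → Primitive (y ++ x)
  Primitive-conjugate x y (xy≢[] , xy-imprimitive) = yx≢[] , yx-imprimitive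
    where
    yx≢[] : ¬ y ++ x ≡ []
    yx≢[] yx≡[] with _ , xy≡[] ← conjugate-^ʷ y x [] 0 yx≡[] = xy≢[] xy≡[]
    yx-imprimitive : ¬ (∃[ w ] ∃[ j ] (j ≥ 2 × y ++ x ≡ w ^ʷ j))
    yx-imprimitive (w , j , j≥2 , yx≡wʲ) with w′ , xy≡w′ʲ ← conjugate-^ʷ y x w j yx≡wʲ =
      xy-imprimitive (w′ , j , j≥2 , xy≡w′ʲ)

  Primitive⇒exponent≡1 : ∀ {x : List A} w i → Primitive x → x ≡ w ^ʷ i → i ≡ 1
  Primitive⇒exponent≡1 w zero          (x≢[] , _)           x≡wⁱ = ⊥-elim (x≢[] x≡wⁱ)
  Primitive⇒exponent≡1 w (suc zero)    _                    _    = refl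
  Primitive⇒exponent≡1 w (suc (suc i)) (_ , x-imprimitive) x≡wⁱ =
    ⊥-elim (x-imprimitive (w , suc (suc i) , s≤s (s≤s z≤n) , x≡wⁱ))

  CommonRoot-Primitive⇒≡ : ∀ {x y : List A} → Primitive x → Primitive y → CommonRoot x y → x ≡ y
  CommonRoot-Primitive⇒≡ x-prim y-prim (w , i , j , x≡wⁱ , y≡wʲ) = begin
    _       ≡⟨ x≡wⁱ ⟩
    w ^ʷ i  ≡⟨ cong (w ^ʷ_) (Primitive⇒exponent≡1 w i x-prim x≡wⁱ) ⟩
    w ^ʷ 1  ≡⟨ cong (w ^ʷ_) (sym (Primitive⇒exponent≡1 w j y-prim y≡wʲ)) ⟩
    w ^ʷ j  ≡⟨ sym y≡wʲ ⟩
    _       ∎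
    where open ≡-Reasoning

  CommonRoot-sym : ∀ {x y : List A} → CommonRoot x y → CommonRoot y x
  CommonRoot-sym (w , i , j , x≡wⁱ , y≡wʲ) = w , j , i , y≡wʲ , x≡wⁱ

  CommonRoot-++ : ∀ {x y y′ : List A} → y ≡ x ++ y′ → CommonRoot x y′ → CommonRoot x y
  CommonRoot-++ y≡xy′ (w , i , j , refl , refl) = w , i , i + j , refl , trans y≡xy′ (sym (^ʷ-+ w i j))

  prefix-of-^ʷ⇒periodic : ∀ (z t x : List A) N → z ++ t ≡ x ^ʷ N → IsPrefix z (x ++ z)
  prefix-of-^ʷ⇒periodic z t x N zt≡xᴺ =
    let e , xz≡ze , _ = levi z (t ++ x) (x ++ z) t zt-x≡x-zt (length-++-≤ʳ z {x}) in e , sym xz≡ze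
    where
    open ≡-Reasoning
    zt-x≡x-zt : z ++ (t ++ x) ≡ (x ++ z) ++ t
    zt-x≡x-zt = begin
      z ++ (t ++ x)   ≡⟨ sym (++-assoc z t x) ⟩
      (z ++ t) ++ x   ≡⟨ cong (_++ x) zt≡xᴺ ⟩
      x ^ʷ N ++ x     ≡⟨ ^ʷ-comm x N ⟩
      x ++ x ^ʷ N     ≡⟨ cong (x ++_) (sym zt≡xᴺ) ⟩
      x ++ (z ++ t)   ≡⟨ sym (++-assoc x z t) ⟩
      (x ++ z) ++ t   ∎

  length≤fineWilfBound : ∀ {x : List A} y → ¬ x ≡ [] → length y ≤ fineWilfBound x y
  length≤fineWilfBound {x} y x≢[] = n≤m+n∸o (length x) (length y) (gcd[m,n]≤m (length y) (length-pos x≢[]))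

  fineWilfBound-++ : ∀ {x y y′ z e : List A} → ¬ x ≡ [] → y ≡ x ++ y′ → z ≡ x ++ e →
                     fineWilfBound x y ≤ length z → fineWilfBound x y′ ≤ length e
  fineWilfBound-++ {x} {y} {y′} {z} {e} x≢[] y≡xy′ z≡xe bound =
    +-∸-cancelˡ-≤ X (≤-trans (gcd[m,n]≤m (length y′) (length-pos x≢[])) (m≤m+n X (length y′))) (begin
      X + (X + length y′) ∸ gcd X (length y′)      ≡⟨ cong (λ g → X + (X + length y′) ∸ g)
                                                         (sym (gcd[m,m+n]≡gcd[m,n] X (length y′))) ⟩
      X + (X + length y′) ∸ gcd X (X + length y′)  ≡⟨ cong (λ l → X + l ∸ gcd X l)
                                                         (sym (trans (cong length y≡xy′) (length-++ x))) ⟩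
      fineWilfBound x y                            ≤⟨ bound ⟩
      length z                                     ≡⟨ trans (cong length z≡xe) (length-++ x) ⟩
      X + length e                                 ∎)
    where
    open ≤-Reasoning
    X = length x

  -- IsPrefix z (x ++ z) says that z is a prefix of x^ω.  This is one step of the
  -- Euclidean algorithm on the periods |x| ≤ |y| of z.
  fine-wilf-step : ∀ (x y z : List A) → ¬ x ≡ [] → length x ≤ length y →
                   IsPrefix z (x ++ z) → IsPrefix z (y ++ z) → fineWilfBound x y ≤ length z →
                   ∃[ y′ ] ∃[ e ] (y ≡ x ++ y′ × IsPrefix e (x ++ e) × IsPrefix e (y′ ++ e) ×
                                   fineWilfBound x y′ ≤ length e)
  fine-wilf-step x y z x≢[] x≤y (t , zt≡xz) (t′ , zt′≡yz) bound
    with y≤z ← ≤-trans (length≤fineWilfBound y x≢[]) bound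
    with e , z≡xe , z≡et  ← levi x z z t  (sym zt≡xz)  (≤-trans x≤y y≤z)
       | f , z≡yf , z≡ft′ ← levi y z z t′ (sym zt′≡yz) y≤z
    with y′ , y≡xy′ , e≡y′f ← levi x e y f (trans (sym z≡xe) z≡yf) x≤y
    with h , e≡fh , _ ← levi f t′ e t (trans (sym z≡ft′) z≡et)
                          (subst (λ e → length f ≤ length e) (sym e≡y′f) (length-++-≤ʳ f {y′}))
    = y′ , e , y≡xy′ , (t , trans (sym z≡et) z≡xe) , (h , eh≡y′e) ,
      fineWilfBound-++ x≢[] y≡xy′ z≡xe bound
    where
    eh≡y′e : e ++ h ≡ y′ ++ e
    eh≡y′e = begin
      e ++ h          ≡⟨ cong (_++ h) e≡y′f ⟩
      (y′ ++ f) ++ h  ≡⟨ ++-assoc y′ f h ⟩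
      y′ ++ (f ++ h)  ≡⟨ cong (y′ ++_) (sym e≡fh) ⟩
      y′ ++ e         ∎
      where open ≡-Reasoning

  fineWilfBound-comm : ∀ (x y : List A) → fineWilfBound x y ≡ fineWilfBound y x
  fineWilfBound-comm x y = cong₂ _∸_ (+-comm (length x) (length y)) (gcd-comm (length x) (length y))

  length-+-< : ∀ (x : List A) {y y′} → ¬ x ≡ [] → y ≡ x ++ y′ →
               length x + length y′ < length x + length y
  length-+-< x {y′ = y′} x≢[] refl =
    +-monoʳ-< (length x) (subst (length y′ <_) (sym (length-++ x)) (+-monoˡ-< (length y′) (length-pos x≢[])))

  fine-wilf-acc : ∀ (x y z : List A) → Acc _<_ (length x + length y) →
                  IsPrefix z (x ++ z) → IsPrefix z (y ++ z) → fineWilfBound x y ≤ length z →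
                  CommonRoot x y
  fine-wilf-acc []          y           z _         _  _  _     = y , 0 , 1 , refl , sym (++-identityʳ y)
  fine-wilf-acc x@(_ ∷ _)   []          z _         _  _  _     = x , 1 , 0 , sym (++-identityʳ x) , refl
  fine-wilf-acc x@(_ ∷ _) y@(_ ∷ _) z (acc rec) zx zy bound with <-≤-connex (length y) (length x)
  ... | inj₂ x≤y =
    let y′ , e , y≡xy′ , ex , ey′ , bound′ = fine-wilf-step x y z (λ ()) x≤y zx zy bound
    in CommonRoot-++ y≡xy′ (fine-wilf-acc x y′ e (rec (length-+-< x (λ ()) y≡xy′)) ex ey′ bound′)
  ... | inj₁ y<x =
    let x′ , e , x≡yx′ , ey , ex′ , bound′ =
          fine-wilf-step y x z (λ ()) (<⇒≤ y<x) zy zx (subst (_≤ length z) (fineWilfBound-comm x y) bound)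
    in CommonRoot-sym (CommonRoot-++ x≡yx′ (fine-wilf-acc y x′ e
         (rec (<-≤-trans (length-+-< y (λ ()) x≡yx′) (≤-reflexive (+-comm (length y) (length x)))))
         ey ex′ bound′))

  fine-wilf : ∀ (x y z : List A) → IsPrefix z (x ++ z) → IsPrefix z (y ++ z) →
              fineWilfBound x y ≤ length z → CommonRoot x y
  fine-wilf x y z = fine-wilf-acc x y z (<-wellFounded _)

  split-inside-^ʷ : ∀ (u : List A) n (s x v : List A) →
                    s ++ x ≡ u ^ʷ n ++ v → length s ≤ length (u ^ʷ n) →
                    ∃[ a ] ∃[ b ] ∃[ k ] (u ≡ a ++ b × x ≡ b ++ (u ^ʷ k ++ v))
  split-inside-^ʷ u zero    [] x v eq _ = u , [] , 0 , sym (++-identityʳ u) , eq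
  split-inside-^ʷ u (suc n) s  x v eq s≤uⁿ⁺¹ with ≤-<-connex (length s) (length u)
  ... | inj₁ s≤u with b , u≡sb , x≡b… ← levi s x u (u ^ʷ n ++ v) (trans eq (++-assoc u _ v)) s≤u =
    s , b , n , u≡sb , x≡b…
  ... | inj₂ u<s
    with s′ , s≡us′ , uⁿv≡s′x ← levi u (u ^ʷ n ++ v) s x (sym (trans eq (++-assoc u _ v))) (<⇒≤ u<s) =
    split-inside-^ʷ u n s′ x v (sym uⁿv≡s′x) (+-cancelˡ-≤ (length u) _ _
      (subst₂ _≤_ (trans (cong length s≡us′) (length-++ u)) (length-++ u) s≤uⁿ⁺¹))

  suffix-starts-inside-^ʷ : ∀ (u ũ v s : List A) n m → ¬ ũ ≡ [] →
    s ++ ũ ^ʷ m ≡ u ^ʷ n ++ v →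
    m * length ũ ≥ length v + length u + length ũ ∸ gcd (length u) (length ũ) →
    length s ≤ length (u ^ʷ n)
  suffix-starts-inside-^ʷ u ũ v s n m ũ≢[] eq bound = +-cancelʳ-≤ V S (length (u ^ʷ n)) (begin
    S + V                   ≡⟨ +-comm S V ⟩
    V + S                   ≤⟨ +-monoˡ-≤ S V≤mQ ⟩
    m * Q + S               ≡⟨ +-comm (m * Q) S ⟩
    S + m * Q               ≡⟨ cong (S +_) (sym (length-^ʷ ũ m)) ⟩
    S + length (ũ ^ʷ m)     ≡⟨ sym (length-++ s) ⟩
    length (s ++ ũ ^ʷ m)    ≡⟨ cong length eq ⟩
    length (u ^ʷ n ++ v)    ≡⟨ length-++ (u ^ʷ n) ⟩
    length (u ^ʷ n) + V     ∎)
    where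
    open ≤-Reasoning
    S = length s
    P = length u
    Q = length ũ
    V = length v
    V≤mQ : V ≤ m * Q
    V≤mQ = ≤-trans (m≤m+n V P)
             (≤-trans (m≤m+n∸o (V + P) Q (gcd[m,n]≤n P Q {{>-nonZero (length-pos ũ≢[])}})) bound)

  conjugate-CommonRoot : ∀ (a b ũ v : List A) k m → ¬ ũ ≡ [] →
    ũ ^ʷ m ≡ b ++ ((a ++ b) ^ʷ k ++ v) →
    m * length ũ ≥ length v + length (a ++ b) + length ũ ∸ gcd (length (a ++ b)) (length ũ) →
    CommonRoot (b ++ a) ũ
  conjugate-CommonRoot a b ũ v k m ũ≢[] ũᵐ≡z++v bound =
    fine-wilf (b ++ a) ũ z (prefix-of-^ʷ⇒periodic z a (b ++ a) (suc k) z++a≡[ba]ᵏ⁺¹)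
                           (prefix-of-^ʷ⇒periodic z v ũ m (sym (trans ũᵐ≡z++v (sym (++-assoc b _ v)))))
                           bound′
    where
    z = b ++ (a ++ b) ^ʷ k
    z++a≡[ba]ᵏ⁺¹ : z ++ a ≡ (b ++ a) ^ʷ suc k
    z++a≡[ba]ᵏ⁺¹ = begin
      (b ++ (a ++ b) ^ʷ k) ++ a  ≡⟨ cong (_++ a) (^ʷ-rotate b a k) ⟩
      ((b ++ a) ^ʷ k ++ b) ++ a  ≡⟨ ++-assoc _ b a ⟩
      (b ++ a) ^ʷ k ++ (b ++ a)  ≡⟨ ^ʷ-comm (b ++ a) k ⟩
      (b ++ a) ^ʷ suc k          ∎
      where open ≡-Reasoning
    P = length (b ++ a)
    Q = length ũ
    V = length v
    bound′ : fineWilfBound (b ++ a) ũ ≤ length z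
    bound′ = +-∸-cancelˡ-≤ V (≤-trans (gcd[m,n]≤n P Q {{>-nonZero (length-pos ũ≢[])}}) (m≤n+m Q P))
      (begin
      V + (P + Q) ∸ gcd P Q    ≡⟨ cong (λ p → V + (p + Q) ∸ gcd p Q) (length-++-comm b a) ⟩
      V + (length (a ++ b) + Q) ∸ gcd (length (a ++ b)) Q
                               ≡⟨ cong (_∸ gcd (length (a ++ b)) Q) (sym (+-assoc V (length (a ++ b)) Q)) ⟩
      V + length (a ++ b) + Q ∸ gcd (length (a ++ b)) Q
                               ≤⟨ bound ⟩
      m * Q                    ≡⟨ sym (length-^ʷ ũ m) ⟩
      length (ũ ^ʷ m)          ≡⟨ cong length (trans ũᵐ≡z++v (sym (++-assoc b _ v))) ⟩
      length (z ++ v)          ≡⟨ length-++ z ⟩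
      length z + V             ≡⟨ +-comm (length z) V ⟩
      V + length z             ∎)
      where open ≤-Reasoning

  tail-conjugation : ∀ (a b v : List A) m k → (b ++ a) ^ʷ m ≡ b ++ ((a ++ b) ^ʷ k ++ v) →
                     v ++ (b ++ a) ≡ (a ++ b) ++ v
  tail-conjugation a b v m k eq
    with j , bv≡[ba]ʲ ← ^ʷ≡^ʷ++⇒^ʷ (b ++ a) (b ++ v) m k (trans eq (^ʷ-rotate-++ b a k v)) =
    ++-cancelˡ b _ _ (begin
      b ++ (v ++ (b ++ a))      ≡⟨ sym (++-assoc b v _) ⟩
      (b ++ v) ++ (b ++ a)      ≡⟨ cong (_++ (b ++ a)) bv≡[ba]ʲ ⟩
      (b ++ a) ^ʷ j ++ (b ++ a) ≡⟨ ^ʷ-comm (b ++ a) j ⟩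
      (b ++ a) ++ (b ++ a) ^ʷ j ≡⟨ cong ((b ++ a) ++_) (sym bv≡[ba]ʲ) ⟩
      (b ++ a) ++ (b ++ v)      ≡⟨ ++-assoc b a _ ⟩
      b ++ (a ++ (b ++ v))      ≡⟨ cong (b ++_) (sym (++-assoc a b v)) ⟩
      b ++ ((a ++ b) ++ v)      ∎)
    where open ≡-Reasoning

  conjugate⇒^ʷ-++-^ʷ : ∀ {x y v : List A} → v ++ y ≡ x ++ v →
                       ∀ n q → x ^ʷ n ++ v ++ y ^ʷ q ≡ x ^ʷ (n + q) ++ v
  conjugate⇒^ʷ-++-^ʷ {x} {y} {v} vy≡xv n q = begin
    x ^ʷ n ++ v ++ y ^ʷ q      ≡⟨ cong (x ^ʷ n ++_) (^ʷ-conjugate vy≡xv q) ⟩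
    x ^ʷ n ++ (x ^ʷ q ++ v)    ≡⟨ sym (++-assoc (x ^ʷ n) _ v) ⟩
    (x ^ʷ n ++ x ^ʷ q) ++ v    ≡⟨ cong (_++ v) (sym (^ʷ-+ x n q)) ⟩
    x ^ʷ (n + q) ++ v          ∎
    where open ≡-Reasoning

lemma3p9 : ∀ {a} {A : Set a} (u ũ v : List A) (n m : ℕ) →
    Primitive u → Primitive ũ →
    IsSuffix (ũ ^ʷ m) ((u ^ʷ n) ++ v) →
    m * length ũ ≥ length v + length u + length ũ ∸ gcd (length u) (length ũ) →
    length u ≡ length ũ × CyclicShift u ũ ×
      (∀ (q : ℕ) → (u ^ʷ n) ++ v ++ (ũ ^ʷ q) ≡ (u ^ʷ (n + q)) ++ v)
lemma3p9 u ũ v n m u-prim ũ-prim@(ũ≢[] , _) (s , s++ũᵐ≡uⁿv) bound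
  with a , b , k , refl , ũᵐ≡b[ab]ᵏv ←
         split-inside-^ʷ u n s (ũ ^ʷ m) v s++ũᵐ≡uⁿv
           (suffix-starts-inside-^ʷ u ũ v s n m ũ≢[] s++ũᵐ≡uⁿv bound)
  with refl ← CommonRoot-Primitive⇒≡ ũ-prim (Primitive-conjugate a b u-prim)
                (CommonRoot-sym (conjugate-CommonRoot a b ũ v k m ũ≢[] ũᵐ≡b[ab]ᵏv bound))
  = length-++-comm a b , (a , b , refl , refl) ,
    conjugate⇒^ʷ-++-^ʷ (tail-conjugation a b v m k ũᵐ≡b[ab]ᵏv) n
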